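{- Let $G=(V,E,w)$ be a finite simple undirected graph with positive vertex weights, let $\{u,u'\}$ be a vertex-cut of size two in $G$, and let $G^*$ be a connected component of $G-\{u,u'\}$, where $\alpha(G^*-N[u])\ge\alpha(G^*-N[u'])$. Construct $G'$ from $G$ by removing the vertices of $G^*$, adding three new vertices $v_1,v_2,v_3$ with weights $w(v_1)=\alpha(G^*-N[u'])-\alpha(G^*-N[\{u,u'\}])$, $w(v_2)=\alpha(G^*-N[u])-\alpha(G^*-N[\{u,u'\}])$, $w(v_3)=\alpha(G^*)-\alpha(G^*-N[u])$, and adding the five edges $uv_1$, $v_1v_2$, $v_2u'$, $uv_3$, $u'v_3$. Then $\alpha(G)=\alpha(G')+\alpha(G^*-N[\{u,u'\}])$.
   Context: $\alpha(H)$ denotes the maximum total vertex weight of an independent set in the weighted graph $H$ (all subgraphs inherit the weights of $G$; the new vertices may have weight zero). For $X\subseteq V$, $N[X]$ is the closed neighborhood of $X$ in $G$ (the vertices of $X$ together with all vertices adjacent to some vertex of $X$), $N[u]=N[\{u\}]$, and $H-X$ denotes the subgraph of $H$ induced by the vertices of $H$ not in $X$.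
   Formalization: The vertex weights of G take values in the positive rationals. -}

module Defs where

open import Data.Bool using (Bool; true; false; not; _∧_; _∨_; if_then_else_)
open import Data.Nat using (ℕ; zero; suc) renaming (_+_ to _+ℕ_)
open import Data.Fin using (Fin; zero; suc; splitAt; _≟_)
open import Data.Fin.Subset using (Subset; _∈_; _∉_; ⁅_⁆; ∁; _∩_; _∪_; ⊤)
open import Data.Vec using (Vec; []; _∷_; lookup; tabulate)
open import Data.List using (List; []; _∷_; map; foldr; allFin; concatMap; filter)
open import Data.List.Relation.Unary.All using (All)
open import Data.Sum using (_⊎_; inj₁; inj₂)
open import Data.Product using (Σ; _×_; ∃; ∃-syntax)
open import Data.Rational using (ℚ; 0ℚ; _+_; _-_; _⊔_; _<_)
open import Relation.Binary.PropositionalEquality using (_≡_; _≢_)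
open import Relation.Nullary using (¬_)
open import Relation.Nullary.Decidable using (⌊_⌋)

Adj : ℕ → Set
Adj n = Fin n → Fin n → Bool

Weight : ℕ → Set
Weight n = Fin n → ℚ

IsSimple : ∀ {n} → Adj n → Set
IsSimple {n} adj = (∀ (x y : Fin n) → adj x y ≡ adj y x) × (∀ (x : Fin n) → adj x x ≡ false)

PositiveWeights : ∀ {n} → Weight n → Set
PositiveWeights {n} w = ∀ (x : Fin n) → 0ℚ < w x

allSubsets : ∀ n → List (Subset n)
allSubsets zero = [] ∷ []
allSubsets (suc n) = concatMap (λ T → (true ∷ T) ∷ (false ∷ T) ∷ []) (allSubsets n)

subsetB : ∀ {n} → Subset n → Subset n → Bool
subsetB {n} T S = foldr _∧_ true (map (λ x → not (lookup T x) ∨ lookup S x) (allFin n))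

independentB : ∀ {n} → Adj n → Subset n → Bool
independentB {n} adj T =
  foldr _∧_ true
    (concatMap (λ x → map (λ y → not (lookup T x ∧ lookup T y ∧ adj x y)) (allFin n)) (allFin n))

weightOf : ∀ {n} → Weight n → Subset n → ℚ
weightOf {n} w T = foldr _+_ 0ℚ (map (λ x → if lookup T x then w x else 0ℚ) (allFin n))

-- α of the subgraph induced by S: maximum total weight of an independent
-- set T ⊆ S (the empty set has weight 0 and is always a candidate).
α : ∀ {n} → Adj n → Weight n → Subset n → ℚ
α {n} adj w S =
  foldr _⊔_ 0ℚ
    (map (weightOf w)
      (filter (λ T → Data.Bool.T? (subsetB T S ∧ independentB adj T)) (allSubsets n)))
  where import Data.Bool

N[_] : ∀ {n} → Adj n → Subset n → Subset n
N[_] {n} adj X = tabulate (λ x → lookup X x ∨ foldr _∨_ false (map (λ y → lookup X y ∧ adj y x) (allFin n)))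

data Reach {n} (adj : Adj n) (S : Subset n) : Fin n → Fin n → Set where
  here : ∀ {x} → x ∈ S → Reach adj S x x
  step : ∀ {x y z} → x ∈ S → adj x y ≡ true → Reach adj S y z → Reach adj S x z

IsComponent : ∀ {n} → Adj n → Subset n → Subset n → Set
IsComponent {n} adj S C =
  (∃[ x ] x ∈ C)
  × (∀ x → x ∈ C → x ∈ S)
  × (∀ x y → x ∈ C → y ∈ C → Reach adj S x y)
  × (∀ x y → x ∈ C → y ∈ S → adj x y ≡ true → y ∈ C)

IsVertexCut2 : ∀ {n} → Adj n → Fin n → Fin n → Set
IsVertexCut2 {n} adj u u' =
  u ≢ u' ×
  ∃[ x ] ∃[ y ] (x ∈ ∁ (⁅ u ⁆ ∪ ⁅ u' ⁆) × y ∈ ∁ (⁅ u ⁆ ∪ ⁅ u' ⁆)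
                 × ¬ Reach adj (∁ (⁅ u ⁆ ∪ ⁅ u' ⁆)) x y)

-- G' lives on Fin (n + 3): splitAt n sends the
-- old vertices to inj₁ and the new vertices v₁ v₂ v₃ to inj₂ 0, 1, 2.
-- G' is the subgraph of this graph induced by (V ∖ G*) ∪ {v₁,v₂,v₃}.

eqB : ∀ {n} → Fin n → Fin n → Bool
eqB x y = ⌊ x ≟ y ⌋

oldNew : ∀ {n} → Fin n → Fin n → Fin n → Fin 3 → Bool
oldNew u u' x zero = eqB x u
oldNew u u' x (suc zero) = eqB x u'
oldNew u u' x (suc (suc zero)) = eqB x u ∨ eqB x u'

newNew : Fin 3 → Fin 3 → Bool
newNew zero (suc zero) = true
newNew (suc zero) zero = true
newNew _ _ = false

adj' : ∀ {n} → Adj n → Fin n → Fin n → Adj (n +ℕ 3)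
adj' {n} adj u u' a b with splitAt n a | splitAt n b
... | inj₁ x | inj₁ y = adj x y
... | inj₁ x | inj₂ i = oldNew u u' x i
... | inj₂ i | inj₁ x = oldNew u u' x i
... | inj₂ i | inj₂ j = newNew i j

minusN : ∀ {n} → Adj n → Subset n → Subset n → Subset n
minusN adj C X = C ∩ ∁ (N[ adj ] X)

newWeight : ∀ {n} → Adj n → Weight n → Fin n → Fin n → Subset n → Fin 3 → ℚ
newWeight adj w u u' C zero =
  α adj w (minusN adj C ⁅ u' ⁆) - α adj w (minusN adj C (⁅ u ⁆ ∪ ⁅ u' ⁆))
newWeight adj w u u' C (suc zero) =
  α adj w (minusN adj C ⁅ u ⁆) - α adj w (minusN adj C (⁅ u ⁆ ∪ ⁅ u' ⁆))
newWeight adj w u u' C (suc (suc zero)) =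
  α adj w C - α adj w (minusN adj C ⁅ u ⁆)

w' : ∀ {n} → Adj n → Weight n → Fin n → Fin n → Subset n → Weight (n +ℕ 3)
w' {n} adj w u u' C a with splitAt n a
... | inj₁ x = w x
... | inj₂ i = newWeight adj w u u' C i

V' : ∀ {n} → Subset n → Subset (n +ℕ 3)
V' {n} C = tabulate f
  where
  f : Fin (n +ℕ 3) → Bool
  f a with splitAt n a
  ... | inj₁ x = not (lookup C x)
  ... | inj₂ _ = true

{-# OPTIONS --safe #-}
module Submission where

-- An independent set of G meets G* in an independent set of G* − N[X], where X is its trace on
-- {u, u'}, and meets the rest of G in an independent set with the same trace. The new vertices are
-- weighted so that, for every trace X, the heaviest set of new vertices compatible with X weighs
-- exactly α(G* − N[X]) − α(G* − N[{u, u'}]); for X = ∅ this needs w(v₁) ≤ w(v₂), which is the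
-- hypothesis α(G* − N[u']) ≤ α(G* − N[u]). As every edge leaving G* ends in u or u', trading the
-- G*-part of an independent set for the matching new vertices, or back, proves both inequalities.

open import Defs
open import Data.Nat using (ℕ; zero; suc) renaming (_+_ to _+ℕ_)
open import Data.Fin using (Fin; zero; suc; _↑ˡ_; _↑ʳ_; splitAt; _≟_)
open import Data.Fin.Properties using (splitAt-↑ˡ; splitAt-↑ʳ; splitAt⁻¹-↑ˡ; splitAt⁻¹-↑ʳ)
open import Data.Fin.Subset using (Subset; _∈_; _∉_; _⊆_; ⁅_⁆; ∁; _∪_; _∩_; ⊤; ⊥)
open import Data.Fin.Subset.Properties
  using (∉⊥; ⊥⊆; ⊆⊤; x∈⁅x⁆; x∈⁅y⁆⇒x≡y; x∈p∩q⁺; x∈p∩q⁻; p∩q⊆p; p∩q⊆q;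
         x∈p∪q⁺; x∈p∪q⁻; x∈∁p⇒x∉p; x∉p⇒x∈∁p; p∪∁p≡⊤; ∪-comm; ∩-distribˡ-∪; ∩-identityʳ)
open import Data.Rational using (ℚ; 0ℚ; _+_; _-_; -_; _⊔_; _≤_)
import Data.Rational.Properties as ℚ
open import Data.Rational.Solver using (module +-*-Solver)
open import Data.Bool using (Bool; true; false; not; _∧_; _∨_; if_then_else_; T; T?)
open import Data.Bool.Properties using (T-≡; T-not-≡; T-∧; T-∨; ∨-zeroʳ)
open import Data.Vec using ([]; _∷_; lookup; _++_; here; there)
open import Data.Vec.Properties
  using ([]=⇒lookup; lookup⇒[]=; lookup-zipWith; lookup-replicate; lookup∘tabulate; lookup-++ˡ; lookup-++ʳ)
import Data.Vec as Vec
open import Data.List using (_∷_; foldr; map; concatMap; filter; allFin)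
import Data.List as List
open import Data.List.Properties using (foldr-forcesᵇ; foldr-preservesᵇ)
open import Data.List.Relation.Unary.All using (All)
import Data.List.Relation.Unary.All.Properties as Allₚ
open import Data.List.Relation.Unary.Any using (here; there)
import Data.List.Relation.Unary.Any as Any
import Data.List.Relation.Unary.Any.Properties as Anyₚ
open import Data.List.Membership.Propositional using () renaming (_∈_ to _∈ₗ_)
open import Data.List.Membership.Propositional.Properties
  using (∈-map⁺; ∈-map⁻; ∈-filter⁺; ∈-filter⁻; ∈-concatMap⁺; foldr-selective)
open import Data.Product using (∃-syntax; _×_; _,_; proj₁; proj₂)
open import Data.Sum using (_⊎_; inj₁; inj₂)
open import Data.Unit using (tt)
open import Data.Empty using (⊥-elim) renaming (⊥ to Empty)
open import Function using (_∘_; _∋_; flip; Equivalence)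
open import Relation.Binary.PropositionalEquality
open import Relation.Nullary using (yes; no)
open import Relation.Nullary.Decidable using (dec-true; isYes≗does)
open import Algebra.Properties.CommutativeMonoid.Sum ℚ.+-0-commutativeMonoid
  using (sum; sum-cong-≗; sum-replicate-zero)
open import Algebra.Bundles using (CommutativeMonoid)
open import Algebra.Properties.CommutativeSemigroup
  (CommutativeMonoid.commutativeSemigroup ℚ.+-0-commutativeMonoid) using (interchange)

open Equivalence using (to; from)

T-and⁺ : ∀ bs → T (foldr _∧_ true bs) → All T bs
T-and⁺ = foldr-forcesᵇ (λ x y → to (T-∧ {x} {y})) true

T-and⁻ : ∀ {bs} → All T bs → T (foldr _∧_ true bs)
T-and⁻ = foldr-preservesᵇ (λ Tx Ty → from T-∧ (Tx , Ty)) tt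

all-allFin⁻ : ∀ {n} (p : Fin n → Bool) → T (foldr _∧_ true (map p (allFin n))) → ∀ x → T (p x)
all-allFin⁻ p h = Allₚ.tabulate⁻ (Allₚ.map⁻ (T-and⁺ _ h))

all-allFin⁺ : ∀ {n} (p : Fin n → Bool) → (∀ x → T (p x)) → T (foldr _∧_ true (map p (allFin n)))
all-allFin⁺ p h = T-and⁻ (Allₚ.map⁺ (Allₚ.tabulate⁺ h))

all²-allFin⁻ : ∀ {n} (p : Fin n → Fin n → Bool) →
               T (foldr _∧_ true (concatMap (λ x → map (p x) (allFin n)) (allFin n))) →
               ∀ x y → T (p x y)
all²-allFin⁻ p h x = all-allFin⁻ (p x) (T-and⁻ (Allₚ.tabulate⁻ (Allₚ.map⁻ (Allₚ.concat⁻ (T-and⁺ _ h))) x))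

all²-allFin⁺ : ∀ {n} (p : Fin n → Fin n → Bool) → (∀ x y → T (p x y)) →
               T (foldr _∧_ true (concatMap (λ x → map (p x) (allFin n)) (allFin n)))
all²-allFin⁺ p h = T-and⁻ (Allₚ.concat⁺ (Allₚ.map⁺ (Allₚ.tabulate⁺ λ x → T-and⁺ _ (all-allFin⁺ (p x) (h x)))))

any-allFin⁻ : ∀ {n} (p : Fin n → Bool) → T (foldr _∨_ false (map p (allFin n))) → ∃[ x ] T (p x)
any-allFin⁻ p h = Anyₚ.tabulate⁻ (Anyₚ.any⁻ p _ h)

any-allFin⁺ : ∀ {n} (p : Fin n → Bool) x → T (p x) → T (foldr _∨_ false (map p (allFin n)))
any-allFin⁺ p x px = Anyₚ.any⁺ p (Anyₚ.tabulate⁺ x px)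

∧≡false : ∀ {a b} → (a ≡ true → b ≡ true → Empty) → a ∧ b ≡ false
∧≡false {true} {true} both = ⊥-elim (both refl refl)
∧≡false {true} {false} _ = refl
∧≡false {false} _ = refl

module _ {n} {S : Subset n} {x : Fin n} where

  ∈⇒T : x ∈ S → T (lookup S x)
  ∈⇒T x∈S = from T-≡ ([]=⇒lookup x∈S)

  T⇒∈ : T (lookup S x) → x ∈ S
  T⇒∈ h = lookup⇒[]= x S (to T-≡ h)

  ∉⇒lookup≡false : x ∉ S → lookup S x ≡ false
  ∉⇒lookup≡false x∉S with lookup S x in e
  ... | true = ⊥-elim (x∉S (lookup⇒[]= x S e))
  ... | false = refl

  lookup≡false⇒∉ : lookup S x ≡ false → x ∉ S
  lookup≡false⇒∉ e x∈S with trans (sym e) ([]=⇒lookup x∈S)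
  ... | ()

Independent : ∀ {n} → Adj n → Subset n → Set
Independent adj I = ∀ {x y} → x ∈ I → y ∈ I → adj x y ≡ false

module _ {n} {I S : Subset n} where

  subsetB-sound : T (subsetB I S) → I ⊆ S
  subsetB-sound h {x} x∈I =
    T⇒∈ (subst (λ b → T (not b ∨ lookup S x)) ([]=⇒lookup x∈I) (all-allFin⁻ _ h x))

  subsetB-complete : I ⊆ S → T (subsetB I S)
  subsetB-complete I⊆S = all-allFin⁺ _ member
    where
    member : ∀ x → T (not (lookup I x) ∨ lookup S x)
    member x with lookup I x in e
    ... | true = ∈⇒T (I⊆S (lookup⇒[]= x I e))
    ... | false = tt

module _ {n} {adj : Adj n} {I : Subset n} where

  independentB-sound : T (independentB adj I) → Independent adj I
  independentB-sound h {x} {y} x∈I y∈I =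
    to T-not-≡ (subst₂ (λ a b → T (not (a ∧ b ∧ adj x y))) ([]=⇒lookup x∈I) ([]=⇒lookup y∈I)
                       (all²-allFin⁻ _ h x y))

  independentB-complete : Independent adj I → T (independentB adj I)
  independentB-complete indep = all²-allFin⁺ _ pair
    where
    pair : ∀ x y → T (not (lookup I x ∧ lookup I y ∧ adj x y))
    pair x y with lookup I x in ex | lookup I y in ey
    ... | false | _ = tt
    ... | true | false = tt
    ... | true | true = from T-not-≡ (indep (lookup⇒[]= x I ex) (lookup⇒[]= y I ey))

Independent-⊆ : ∀ {n} {adj : Adj n} {I J : Subset n} → I ⊆ J → Independent adj J → Independent adj I
Independent-⊆ I⊆J indep x∈I y∈I = indep (I⊆J x∈I) (I⊆J y∈I)

Independent-∪ : ∀ {n} {adj : Adj n} {I J : Subset n} → (∀ x y → adj x y ≡ adj y x) →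
                Independent adj I → Independent adj J →
                (∀ {x y} → x ∈ I → y ∈ J → adj x y ≡ false) → Independent adj (I ∪ J)
Independent-∪ {I = I} {J} symmetric indI indJ across {x} {y} x∈ y∈
  with x∈p∪q⁻ I J x∈ | x∈p∪q⁻ I J y∈
... | inj₁ x∈I | inj₁ y∈I = indI x∈I y∈I
... | inj₁ x∈I | inj₂ y∈J = across x∈I y∈J
... | inj₂ x∈J | inj₁ y∈I = trans (symmetric x y) (across y∈I x∈J)
... | inj₂ x∈J | inj₂ y∈J = indJ x∈J y∈J

pick : Bool → ℚ → ℚ
pick t x = if t then x else 0ℚ

pick-≤ : ∀ {x} → 0ℚ ≤ x → ∀ t → pick t x ≤ x
pick-≤ 0≤x true = ℚ.≤-refl
pick-≤ 0≤x false = 0≤x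

sum-+ : ∀ {m} (f g : Fin m → ℚ) → sum (λ i → f i + g i) ≡ sum f + sum g
sum-+ {zero} f g = sym (ℚ.+-identityˡ 0ℚ)
sum-+ {suc m} f g = trans (cong (f zero + g zero +_) (sum-+ (f ∘ suc) (g ∘ suc)))
                          (interchange (f zero) (g zero) (sum (f ∘ suc)) (sum (g ∘ suc)))

sum-↑ : ∀ m {k} (f : Fin (m +ℕ k) → ℚ) → sum f ≡ sum (f ∘ (_↑ˡ k)) + sum (f ∘ (m ↑ʳ_))
sum-↑ zero f = sym (ℚ.+-identityˡ _)
sum-↑ (suc m) f = trans (cong (f zero +_) (sum-↑ m (f ∘ suc))) (sym (ℚ.+-assoc (f zero) _ _))

foldr-+-tabulate : ∀ {A : Set} {m} (h : Fin m → A) (f : A → ℚ) →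
                   foldr _+_ 0ℚ (map f (List.tabulate h)) ≡ sum (f ∘ h)
foldr-+-tabulate {m = zero} h f = refl
foldr-+-tabulate {m = suc m} h f = cong (f (h zero) +_) (foldr-+-tabulate (h ∘ suc) f)

module _ {n} (w : Weight n) where

  weightOf≡sum : ∀ S → weightOf w S ≡ sum (λ x → pick (lookup S x) (w x))
  weightOf≡sum S = foldr-+-tabulate {m = n} (λ x → x) (λ x → pick (lookup S x) (w x))

  weightOf-⊥ : weightOf w ⊥ ≡ 0ℚ
  weightOf-⊥ = begin
    weightOf w ⊥                          ≡⟨ weightOf≡sum ⊥ ⟩
    sum (λ x → pick (lookup ⊥ x) (w x))   ≡⟨ sum-cong-≗ {n} (λ x → cong (flip pick (w x)) (lookup-replicate x false)) ⟩
    sum {n} (λ _ → 0ℚ)                    ≡⟨ sum-replicate-zero n ⟩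
    0ℚ                                    ∎
    where open ≡-Reasoning

  weightOf-∪ : ∀ {I J} → (∀ {x} → x ∈ I → x ∉ J) → weightOf w (I ∪ J) ≡ weightOf w I + weightOf w J
  weightOf-∪ {I} {J} disjoint = begin
    weightOf w (I ∪ J)                    ≡⟨ weightOf≡sum (I ∪ J) ⟩
    sum (λ x → ind (I ∪ J) x)             ≡⟨ sum-cong-≗ {n} pointwise ⟩
    sum (λ x → ind I x + ind J x)         ≡⟨ sum-+ (ind I) (ind J) ⟩
    sum (ind I) + sum (ind J)             ≡⟨ sym (cong₂ _+_ (weightOf≡sum I) (weightOf≡sum J)) ⟩
    weightOf w I + weightOf w J           ∎
    where
    open ≡-Reasoning
    ind : Subset n → Fin n → ℚ
    ind S x = pick (lookup S x) (w x)
    pointwise : ∀ x → ind (I ∪ J) x ≡ ind I x + ind J x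
    pointwise x rewrite lookup-zipWith _∨_ x I J with lookup I x in ex | lookup J x in ey
    ... | true | true = ⊥-elim (disjoint (lookup⇒[]= x I ex) (lookup⇒[]= x J ey))
    ... | true | false = sym (ℚ.+-identityʳ (w x))
    ... | false | _ = sym (ℚ.+-identityˡ _)

  weightOf-partition : ∀ S P → weightOf w S ≡ weightOf w (S ∩ ∁ P) + weightOf w (S ∩ P)
  weightOf-partition S P = trans (cong (weightOf w) S≡) (weightOf-∪ disjoint)
    where
    S≡ : S ≡ (S ∩ ∁ P) ∪ (S ∩ P)
    S≡ = begin
      S                     ≡⟨ sym (∩-identityʳ S) ⟩
      S ∩ ⊤                 ≡⟨ cong (S ∩_) (trans (sym (p∪∁p≡⊤ P)) (∪-comm P (∁ P))) ⟩
      S ∩ (∁ P ∪ P)         ≡⟨ ∩-distribˡ-∪ S (∁ P) P ⟩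
      (S ∩ ∁ P) ∪ (S ∩ P)   ∎
      where open ≡-Reasoning
    disjoint : ∀ {x} → x ∈ S ∩ ∁ P → x ∉ S ∩ P
    disjoint x∈ x∈' = x∈∁p⇒x∉p (proj₂ (x∈p∩q⁻ S _ x∈)) (proj₂ (x∈p∩q⁻ S P x∈'))

∈-allSubsets : ∀ {n} (S : Subset n) → S ∈ₗ allSubsets n
∈-allSubsets [] = here refl
∈-allSubsets (true ∷ S) = ∈-concatMap⁺ _ (Any.map (λ { refl → here refl }) (∈-allSubsets S))
∈-allSubsets (false ∷ S) = ∈-concatMap⁺ _ (Any.map (λ { refl → there (here refl) }) (∈-allSubsets S))

≤-foldr-⊔ : ∀ {v e xs} → v ∈ₗ xs → v ≤ foldr _⊔_ e xs
≤-foldr-⊔ (here refl) = ℚ.p≤p⊔q _ _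
≤-foldr-⊔ {xs = x ∷ _} (there v∈xs) = ℚ.p≤q⇒p≤r⊔q x (≤-foldr-⊔ v∈xs)

module _ {n} (adj : Adj n) (w : Weight n) where

  private
    isCandidate : Subset n → Subset n → Bool
    isCandidate S I = subsetB I S ∧ independentB adj I

  α-upper : ∀ {S I} → I ⊆ S → Independent adj I → weightOf w I ≤ α adj w S
  α-upper {S} {I} I⊆S indep = ≤-foldr-⊔ (∈-map⁺ (weightOf w) (∈-filter⁺ (T? ∘ isCandidate S) (∈-allSubsets I)
    (from T-∧ (subsetB-complete I⊆S , independentB-complete indep))))

  α-attained : ∀ S → ∃[ I ] (I ⊆ S × Independent adj I × α adj w S ≡ weightOf w I)
  α-attained S with foldr-selective ℚ.⊔-sel 0ℚ (map (weightOf w) (filter (T? ∘ isCandidate S) (allSubsets n)))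
  ... | inj₁ α≡0 = ⊥ , ⊥⊆ , (λ x∈⊥ → ⊥-elim (∉⊥ x∈⊥)) , trans α≡0 (sym (weightOf-⊥ w))
  ... | inj₂ α∈ with ∈-map⁻ (weightOf w) α∈
  ...   | I , I∈ , α≡ with to T-∧ (proj₂ (∈-filter⁻ (T? ∘ isCandidate S) {xs = allSubsets n} I∈))
  ...     | I⊆S , indep = I , subsetB-sound I⊆S , independentB-sound indep , α≡

  α-mono : ∀ {S S'} → S ⊆ S' → α adj w S ≤ α adj w S'
  α-mono {S} S⊆S' with α-attained S
  ... | I , I⊆S , indep , α≡ = subst (_≤ _) (sym α≡) (α-upper (S⊆S' ∘ I⊆S) indep)

module _ {n} {adj : Adj n} {X : Subset n} {x : Fin n} where

  ∈N[]⁻ : x ∈ N[ adj ] X → x ∈ X ⊎ ∃[ y ] (y ∈ X × adj y x ≡ true)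
  ∈N[]⁻ x∈N with to T-∨ (subst T (lookup∘tabulate _ x) (∈⇒T x∈N))
  ... | inj₁ x∈X = inj₁ (T⇒∈ x∈X)
  ... | inj₂ h with any-allFin⁻ (λ y → lookup X y ∧ adj y x) h
  ...   | y , h' with to T-∧ h'
  ...     | y∈X , adj≡ = inj₂ (y , T⇒∈ y∈X , to T-≡ adj≡)

  adj⇒∈N[] : ∀ {y} → y ∈ X → adj y x ≡ true → x ∈ N[ adj ] X
  adj⇒∈N[] {y} y∈X adj≡ = T⇒∈ (subst T (sym (lookup∘tabulate _ x)) (from T-∨ (inj₂
    (any-allFin⁺ (λ z → lookup X z ∧ adj z x) y (from T-∧ (∈⇒T y∈X , from T-≡ adj≡))))))

module _ {n} {adj : Adj n} {C X : Subset n} {x : Fin n} where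

  ∈-minusN⁺ : x ∈ C → x ∉ X → (∀ {y} → y ∈ X → adj y x ≡ false) → x ∈ minusN adj C X
  ∈-minusN⁺ x∈C x∉X nonadj = x∈p∩q⁺ (x∈C , x∉p⇒x∈∁p λ x∈N → notInN (∈N[]⁻ x∈N))
    where
    notInN : x ∈ X ⊎ ∃[ y ] (y ∈ X × adj y x ≡ true) → Empty
    notInN (inj₁ x∈X) = x∉X x∈X
    notInN (inj₂ (y , y∈X , adj≡)) with trans (sym (nonadj y∈X)) adj≡
    ... | ()

  ∈-minusN⁻ : x ∈ minusN adj C X → x ∈ C × (∀ {y} → y ∈ X → adj y x ≡ false)
  ∈-minusN⁻ x∈ = proj₁ (x∈p∩q⁻ C _ x∈) , nonadj
    where
    nonadj : ∀ {y} → y ∈ X → adj y x ≡ false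
    nonadj {y} y∈X with adj y x in e
    ... | true = ⊥-elim (x∈∁p⇒x∉p (proj₂ (x∈p∩q⁻ C _ x∈)) (adj⇒∈N[] y∈X e))
    ... | false = refl

data OldOrNew (m k : ℕ) : Fin (m +ℕ k) → Set where
  old : ∀ x → OldOrNew m k (x ↑ˡ k)
  new : ∀ i → OldOrNew m k (m ↑ʳ i)

oldOrNew : ∀ m {k} a → OldOrNew m k a
oldOrNew m a with splitAt m a in eq
... | inj₁ x = subst (OldOrNew m _) (splitAt⁻¹-↑ˡ eq) (old x)
... | inj₂ i = subst (OldOrNew m _) (splitAt⁻¹-↑ʳ eq) (new i)

module _ {m k} {I : Subset m} {t : Subset k} where

  ↑ˡ∈++⁺ : ∀ {x} → x ∈ I → x ↑ˡ k ∈ I ++ t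
  ↑ˡ∈++⁺ {x} x∈I = lookup⇒[]= (x ↑ˡ k) (I ++ t) (trans (lookup-++ˡ I t x) ([]=⇒lookup x∈I))

  ↑ˡ∈++⁻ : ∀ {x} → x ↑ˡ k ∈ I ++ t → x ∈ I
  ↑ˡ∈++⁻ {x} x∈ = lookup⇒[]= x I (trans (sym (lookup-++ˡ I t x)) ([]=⇒lookup x∈))

  ↑ʳ∈++⁺ : ∀ {i} → i ∈ t → m ↑ʳ i ∈ I ++ t
  ↑ʳ∈++⁺ {i} i∈t = lookup⇒[]= (m ↑ʳ i) (I ++ t) (trans (lookup-++ʳ I t i) ([]=⇒lookup i∈t))

  ↑ʳ∈++⁻ : ∀ {i} → m ↑ʳ i ∈ I ++ t → i ∈ t
  ↑ʳ∈++⁻ {i} i∈ = lookup⇒[]= i t (trans (sym (lookup-++ʳ I t i)) ([]=⇒lookup i∈))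

eqB-refl : ∀ {n} (x : Fin n) → eqB x x ≡ true
eqB-refl x = trans (isYes≗does (x ≟ x)) (dec-true (x ≟ x) refl)

-- p and q record whether u and u' are in the independent set; the conjuncts are the gadget edges
-- v₁v₂, uv₁, u'v₂, uv₃, u'v₃.
Compatible : Bool → Bool → Subset 3 → Set
Compatible p q (t₁ ∷ t₂ ∷ t₃ ∷ []) =
  t₁ ∧ t₂ ≡ false × t₁ ∧ p ≡ false × t₂ ∧ q ≡ false × t₃ ∧ p ≡ false × t₃ ∧ q ≡ false

best : Bool → Bool → Subset 3
best false false = false ∷ true  ∷ true  ∷ []
best true  false = false ∷ true  ∷ false ∷ []
best false true  = true  ∷ false ∷ false ∷ []
best true  true  = false ∷ false ∷ false ∷ []

best-compatible : ∀ p q → Compatible p q (best p q)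
best-compatible false false = refl , refl , refl , refl , refl
best-compatible true  false = refl , refl , refl , refl , refl
best-compatible false true  = refl , refl , refl , refl , refl
best-compatible true  true  = refl , refl , refl , refl , refl

p≤q⇒0≤q-p : ∀ {p q} → p ≤ q → 0ℚ ≤ q - p
p≤q⇒0≤q-p {p} {q} p≤q = subst (_≤ q - p) (ℚ.+-inverseʳ p) (ℚ.+-monoˡ-≤ (- p) p≤q)

p≤q-r⇒p+r≤q : ∀ {p q r} → p ≤ q - r → p + r ≤ q
p≤q-r⇒p+r≤q {p} {q} {r} p≤q-r =
  subst (p + r ≤_) (solve 2 (λ q r → (q :- r) :+ r := q) refl q r) (ℚ.+-monoˡ-≤ r p≤q-r)
  where open +-*-Solver

-- value p q stands for α(G* − N[X]) with u ∈ X iff p and u' ∈ X iff q, so that weight lists the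
-- weights of v₁, v₂, v₃.
module Gadget (value : Bool → Bool → ℚ) where

  open +-*-Solver using (solve; _:+_; _:-_; _:=_; con)

  private
    A a₁ a₂ b : ℚ
    A  = value false false
    a₁ = value true false
    a₂ = value false true
    b  = value true true

  weight : Fin 3 → ℚ
  weight zero             = a₂ - b
  weight (suc zero)       = a₁ - b
  weight (suc (suc zero)) = A - a₁

  total : Subset 3 → ℚ
  total t = sum (λ i → pick (lookup t i) (weight i))

  total-best : ∀ p q → total (best p q) + b ≡ value p q
  total-best false false =
    solve 3 (λ A a₁ b → (con 0ℚ :+ ((a₁ :- b) :+ ((A :- a₁) :+ con 0ℚ))) :+ b := A) refl A a₁ b
  total-best true false =
    solve 2 (λ a₁ b → (con 0ℚ :+ ((a₁ :- b) :+ (con 0ℚ :+ con 0ℚ))) :+ b := a₁) refl a₁ b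
  total-best false true =
    solve 2 (λ a₂ b → ((a₂ :- b) :+ (con 0ℚ :+ (con 0ℚ :+ con 0ℚ))) :+ b := a₂) refl a₂ b
  total-best true true =
    solve 1 (λ b → (con 0ℚ :+ (con 0ℚ :+ (con 0ℚ :+ con 0ℚ))) :+ b := b) refl b

  module _ (b≤a₂ : b ≤ a₂) (a₂≤a₁ : a₂ ≤ a₁) (a₁≤A : a₁ ≤ A) where

    private
      -- The only use of α(G* − N[u']) ≤ α(G* − N[u]).
      w₁≤w₂ : a₂ - b ≤ a₁ - b
      w₁≤w₂ = ℚ.+-monoˡ-≤ (- b) a₂≤a₁

      0≤w₂ : 0ℚ ≤ a₁ - b
      0≤w₂ = ℚ.≤-trans (p≤q⇒0≤q-p b≤a₂) w₁≤w₂

      one-of-v₁v₂ : ∀ t₁ t₂ → t₁ ∧ t₂ ≡ false → pick t₁ (a₂ - b) + pick t₂ (a₁ - b) ≤ a₁ - b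
      one-of-v₁v₂ true  false _ = subst (_≤ a₁ - b) (sym (ℚ.+-identityʳ _)) w₁≤w₂
      one-of-v₁v₂ false true  _ = ℚ.≤-reflexive (ℚ.+-identityˡ _)
      one-of-v₁v₂ false false _ = 0≤w₂

      total≤difference : ∀ p q t → Compatible p q t → total t ≤ value p q - b
      total≤difference false false (t₁ ∷ t₂ ∷ t₃ ∷ []) (v₁v₂ , _) = begin
        pick t₁ (a₂ - b) + (pick t₂ (a₁ - b) + (pick t₃ (A - a₁) + 0ℚ))
          ≡⟨ cong (λ z → pick t₁ (a₂ - b) + (pick t₂ (a₁ - b) + z)) (ℚ.+-identityʳ _) ⟩
        pick t₁ (a₂ - b) + (pick t₂ (a₁ - b) + pick t₃ (A - a₁))
          ≡⟨ sym (ℚ.+-assoc (pick t₁ (a₂ - b)) _ _) ⟩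
        (pick t₁ (a₂ - b) + pick t₂ (a₁ - b)) + pick t₃ (A - a₁)
          ≤⟨ ℚ.+-mono-≤ (one-of-v₁v₂ t₁ t₂ v₁v₂) (pick-≤ (p≤q⇒0≤q-p a₁≤A) t₃) ⟩
        (a₁ - b) + (A - a₁)
          ≡⟨ solve 3 (λ A a₁ b → (a₁ :- b) :+ (A :- a₁) := A :- b) refl A a₁ b ⟩
        A - b ∎
        where open ℚ.≤-Reasoning
      total≤difference true false (false ∷ t₂ ∷ false ∷ []) _ = begin
        0ℚ + (pick t₂ (a₁ - b) + (0ℚ + 0ℚ)) ≡⟨ ℚ.+-identityˡ _ ⟩
        pick t₂ (a₁ - b) + 0ℚ               ≡⟨ ℚ.+-identityʳ _ ⟩
        pick t₂ (a₁ - b)                    ≤⟨ pick-≤ 0≤w₂ t₂ ⟩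
        a₁ - b                              ∎
        where open ℚ.≤-Reasoning
      total≤difference true false (true ∷ _ ∷ _ ∷ []) (_ , () , _)
      total≤difference true false (false ∷ _ ∷ true ∷ []) (_ , _ , _ , () , _)
      total≤difference false true (t₁ ∷ false ∷ false ∷ []) _ = begin
        pick t₁ (a₂ - b) + (0ℚ + (0ℚ + 0ℚ)) ≡⟨ ℚ.+-identityʳ _ ⟩
        pick t₁ (a₂ - b)                    ≤⟨ pick-≤ (p≤q⇒0≤q-p b≤a₂) t₁ ⟩
        a₂ - b                              ∎
        where open ℚ.≤-Reasoning
      total≤difference false true (_ ∷ true ∷ _ ∷ []) (_ , _ , () , _)
      total≤difference false true (_ ∷ false ∷ true ∷ []) (_ , _ , _ , _ , ())
      total≤difference true true (false ∷ false ∷ false ∷ []) _ = ℚ.≤-reflexive (sym (ℚ.+-inverseʳ b))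
      total≤difference true true (true ∷ _ ∷ _ ∷ []) (_ , () , _)
      total≤difference true true (false ∷ true ∷ _ ∷ []) (_ , _ , () , _)
      total≤difference true true (false ∷ false ∷ true ∷ []) (_ , _ , _ , () , _)

    total-≤ : ∀ p q t → Compatible p q t → total t + b ≤ value p q
    total-≤ p q t compatible = p≤q-r⇒p+r≤q (total≤difference p q t compatible)

module Reduction {n} (adj : Adj n) (w : Weight n) (u u' : Fin n) (C : Subset n) where

  available : Bool → Bool → Subset n
  available false false = C
  available true  false = minusN adj C ⁅ u ⁆
  available false true  = minusN adj C ⁅ u' ⁆
  available true  true  = minusN adj C (⁅ u ⁆ ∪ ⁅ u' ⁆)

  open Gadget (λ p q → α adj w (available p q)) public

  αG' base : ℚ
  αG' = α (adj' adj u u') (w' adj w u u' C) (V' C)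
  base = α adj w (available true true)

  adj'-old-old : ∀ x y → adj' adj u u' (x ↑ˡ 3) (y ↑ˡ 3) ≡ adj x y
  adj'-old-old x y rewrite splitAt-↑ˡ n x 3 | splitAt-↑ˡ n y 3 = refl

  adj'-old-new : ∀ x i → adj' adj u u' (x ↑ˡ 3) (n ↑ʳ i) ≡ oldNew u u' x i
  adj'-old-new x i rewrite splitAt-↑ˡ n x 3 | splitAt-↑ʳ n 3 i = refl

  adj'-new-old : ∀ i x → adj' adj u u' (n ↑ʳ i) (x ↑ˡ 3) ≡ oldNew u u' x i
  adj'-new-old i x rewrite splitAt-↑ˡ n x 3 | splitAt-↑ʳ n 3 i = refl

  adj'-new-new : ∀ i j → adj' adj u u' (n ↑ʳ i) (n ↑ʳ j) ≡ newNew i j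
  adj'-new-new i j rewrite splitAt-↑ʳ n 3 i | splitAt-↑ʳ n 3 j = refl

  w'-old : ∀ x → w' adj w u u' C (x ↑ˡ 3) ≡ w x
  w'-old x rewrite splitAt-↑ˡ n x 3 = refl

  w'-new : ∀ i → w' adj w u u' C (n ↑ʳ i) ≡ weight i
  w'-new i rewrite splitAt-↑ʳ n 3 i = newWeight≡weight i
    where
    newWeight≡weight : ∀ i → newWeight adj w u u' C i ≡ weight i
    newWeight≡weight zero             = refl
    newWeight≡weight (suc zero)       = refl
    newWeight≡weight (suc (suc zero)) = refl

  V'-old : ∀ x → lookup (V' C) (x ↑ˡ 3) ≡ not (lookup C x)
  V'-old x rewrite (lookup (V' C) (x ↑ˡ 3) ≡ _) ∋ lookup∘tabulate _ (x ↑ˡ 3) | splitAt-↑ˡ n x 3 = refl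

  V'-new : ∀ i → lookup (V' C) (n ↑ʳ i) ≡ true
  V'-new i rewrite (lookup (V' C) (n ↑ʳ i) ≡ _) ∋ lookup∘tabulate _ (n ↑ʳ i) | splitAt-↑ʳ n 3 i = refl

  ++⊆V'⁺ : ∀ {I t} → I ⊆ ∁ C → I ++ t ⊆ V' C
  ++⊆V'⁺ {I} {t} I⊆∁C {a} a∈ with oldOrNew n a
  ... | old x = lookup⇒[]= _ (V' C) (trans (V'-old x) (cong not (∉⇒lookup≡false (x∈∁p⇒x∉p (I⊆∁C (↑ˡ∈++⁻ a∈))))))
  ... | new i = lookup⇒[]= _ (V' C) (V'-new i)

  ++⊆V'⁻ : ∀ {I t} → I ++ t ⊆ V' C → I ⊆ ∁ C
  ++⊆V'⁻ {I} {t} ⊆V' {x} x∈I = x∉p⇒x∈∁p λ x∈C →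
    lookup≡false⇒∉ (trans (V'-old x) (cong not ([]=⇒lookup x∈C))) (⊆V' (↑ˡ∈++⁺ x∈I))

  weightOf-++ : ∀ I t → weightOf (w' adj w u u' C) (I ++ t) ≡ weightOf w I + total t
  weightOf-++ I t = begin
    weightOf (w' adj w u u' C) (I ++ t)
      ≡⟨ weightOf≡sum _ (I ++ t) ⟩
    sum (λ a → pick (lookup (I ++ t) a) (w' adj w u u' C a))
      ≡⟨ sum-↑ n _ ⟩
    sum (λ x → pick (lookup (I ++ t) (x ↑ˡ 3)) (w' adj w u u' C (x ↑ˡ 3))) +
    sum (λ i → pick (lookup (I ++ t) (n ↑ʳ i)) (w' adj w u u' C (n ↑ʳ i)))
      ≡⟨ cong₂ _+_ (sum-cong-≗ {n} λ x → cong₂ pick (lookup-++ˡ I t x) (w'-old x))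
                   (sum-cong-≗ {3} λ i → cong₂ pick (lookup-++ʳ I t i) (w'-new i)) ⟩
    sum (λ x → pick (lookup I x) (w x)) + total t
      ≡⟨ cong (_+ total t) (weightOf≡sum w I) ⟨
    weightOf w I + total t ∎
    where open ≡-Reasoning

  compatible-old-new : ∀ {I t x i} → Compatible (lookup I u) (lookup I u') t →
                       x ∈ I → i ∈ t → oldNew u u' x i ≡ false
  compatible-old-new {I} {_ ∷ _ ∷ _ ∷ []} {x} (_ , u∉I , _) x∈I here with x ≟ u
  ... | yes refl = ⊥-elim (lookup≡false⇒∉ u∉I x∈I)
  ... | no _ = refl
  compatible-old-new {I} {_ ∷ _ ∷ _ ∷ []} {x} (_ , _ , u'∉I , _) x∈I (there here) with x ≟ u'
  ... | yes refl = ⊥-elim (lookup≡false⇒∉ u'∉I x∈I)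
  ... | no _ = refl
  compatible-old-new {I} {_ ∷ _ ∷ _ ∷ []} {x} (_ , _ , _ , u∉I , u'∉I) x∈I (there (there here))
    with x ≟ u | x ≟ u'
  ... | yes refl | _ = ⊥-elim (lookup≡false⇒∉ u∉I x∈I)
  ... | no _ | yes refl = ⊥-elim (lookup≡false⇒∉ u'∉I x∈I)
  ... | no _ | no _ = refl

  compatible-new-new : ∀ {p q t i j} → Compatible p q t → i ∈ t → j ∈ t → newNew i j ≡ false
  compatible-new-new {t = _ ∷ _ ∷ _ ∷ []} (() , _) here (there here)
  compatible-new-new {t = _ ∷ _ ∷ _ ∷ []} (() , _) (there here) here
  compatible-new-new _ here here = refl
  compatible-new-new _ here (there (there here)) = refl
  compatible-new-new _ (there here) (there here) = refl
  compatible-new-new _ (there here) (there (there here)) = refl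
  compatible-new-new _ (there (there here)) _ = refl

  Independent-++⁺ : ∀ {I t} → Independent adj I → Compatible (lookup I u) (lookup I u') t →
                    Independent (adj' adj u u') (I ++ t)
  Independent-++⁺ {I} indep compatible {a} {b} a∈ b∈ with oldOrNew n a | oldOrNew n b
  ... | old x | old y = trans (adj'-old-old x y) (indep (↑ˡ∈++⁻ a∈) (↑ˡ∈++⁻ b∈))
  ... | old x | new j = trans (adj'-old-new x j) (compatible-old-new {I} compatible (↑ˡ∈++⁻ a∈) (↑ʳ∈++⁻ b∈))
  ... | new i | old y = trans (adj'-new-old i y) (compatible-old-new {I} compatible (↑ˡ∈++⁻ b∈) (↑ʳ∈++⁻ a∈))
  ... | new i | new j = trans (adj'-new-new i j) (compatible-new-new compatible (↑ʳ∈++⁻ a∈) (↑ʳ∈++⁻ b∈))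

  Independent-++⁻ : ∀ {I t} → Independent (adj' adj u u') (I ++ t) →
                    Independent adj I × Compatible (lookup I u) (lookup I u') t
  Independent-++⁻ {I} {t₁ ∷ t₂ ∷ t₃ ∷ []} indep =
      (λ x∈I y∈I → trans (sym (adj'-old-old _ _)) (indep (↑ˡ∈++⁺ x∈I) (↑ˡ∈++⁺ y∈I)))
    , ∧≡false (new-new-edge zero (suc zero) refl)
    , ∧≡false (flip (old-new-edge u zero (eqB-refl u)))
    , ∧≡false (flip (old-new-edge u' (suc zero) (eqB-refl u')))
    , ∧≡false (flip (old-new-edge u (suc (suc zero)) (cong (_∨ eqB u u') (eqB-refl u))))
    , ∧≡false (flip (old-new-edge u' (suc (suc zero)) (trans (cong (eqB u' u ∨_) (eqB-refl u')) (∨-zeroʳ _))))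
    where
    t = t₁ ∷ t₂ ∷ t₃ ∷ []
    excluded : ∀ {a b} → adj' adj u u' a b ≡ true → a ∈ I ++ t → b ∈ I ++ t → Empty
    excluded edge a∈ b∈ with trans (sym edge) (indep a∈ b∈)
    ... | ()
    old-new-edge : ∀ x i → oldNew u u' x i ≡ true → lookup I x ≡ true → lookup t i ≡ true → Empty
    old-new-edge x i edge x∈ i∈ =
      excluded (trans (adj'-old-new x i) edge) (↑ˡ∈++⁺ (lookup⇒[]= x I x∈)) (↑ʳ∈++⁺ (lookup⇒[]= i t i∈))
    new-new-edge : ∀ i j → newNew i j ≡ true → lookup t i ≡ true → lookup t j ≡ true → Empty
    new-new-edge i j edge i∈ j∈ =
      excluded (trans (adj'-new-new i j) edge) (↑ʳ∈++⁺ (lookup⇒[]= i t i∈)) (↑ʳ∈++⁺ (lookup⇒[]= j t j∈))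

  ∈-available⁻ : ∀ {p q y} → y ∈ available p q →
                 y ∈ C × (p ≡ true → adj u y ≡ false) × (q ≡ true → adj u' y ≡ false)
  ∈-available⁻ {false} {false} y∈C = y∈C , (λ ()) , (λ ())
  ∈-available⁻ {true}  {false} y∈ with ∈-minusN⁻ y∈
  ... | y∈C , nonadj = y∈C , (λ _ → nonadj (x∈⁅x⁆ u)) , (λ ())
  ∈-available⁻ {false} {true}  y∈ with ∈-minusN⁻ y∈
  ... | y∈C , nonadj = y∈C , (λ ()) , (λ _ → nonadj (x∈⁅x⁆ u'))
  ∈-available⁻ {true}  {true}  y∈ with ∈-minusN⁻ y∈
  ... | y∈C , nonadj = y∈C , (λ _ → nonadj (x∈p∪q⁺ (inj₁ (x∈⁅x⁆ u))))
                           , (λ _ → nonadj (x∈p∪q⁺ (inj₂ (x∈⁅x⁆ u'))))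

  module _ (component : IsComponent adj (∁ (⁅ u ⁆ ∪ ⁅ u' ⁆)) C) where

    private
      ∈C⇒∉cut : ∀ {x} → x ∈ C → x ∉ ⁅ u ⁆ ∪ ⁅ u' ⁆
      ∈C⇒∉cut x∈C = x∈∁p⇒x∉p (proj₁ (proj₂ component) _ x∈C)

      ∉cut : ∀ {x} → x ≢ u → x ≢ u' → x ∉ ⁅ u ⁆ ∪ ⁅ u' ⁆
      ∉cut x≢u x≢u' x∈ with x∈p∪q⁻ ⁅ u ⁆ ⁅ u' ⁆ x∈
      ... | inj₁ x∈⁅u⁆ = x≢u (x∈⁅y⁆⇒x≡y u x∈⁅u⁆)
      ... | inj₂ x∈⁅u'⁆ = x≢u' (x∈⁅y⁆⇒x≡y u' x∈⁅u'⁆)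

      nonadjacent-to : ∀ {z y} → adj z y ≡ false → ∀ {x} → x ∈ ⁅ z ⁆ → adj x y ≡ false
      nonadjacent-to {z} nonadj x∈⁅z⁆ rewrite x∈⁅y⁆⇒x≡y z x∈⁅z⁆ = nonadj

    ∈-available⁺ : ∀ {p q y} → y ∈ C → (p ≡ true → adj u y ≡ false) → (q ≡ true → adj u' y ≡ false) →
                   y ∈ available p q
    ∈-available⁺ {false} {false} y∈C _ _ = y∈C
    ∈-available⁺ {true}  {false} y∈C hu _ =
      ∈-minusN⁺ y∈C (∈C⇒∉cut y∈C ∘ λ y∈⁅u⁆ → x∈p∪q⁺ (inj₁ y∈⁅u⁆)) (nonadjacent-to (hu refl))
    ∈-available⁺ {false} {true}  y∈C _ hu' =
      ∈-minusN⁺ y∈C (∈C⇒∉cut y∈C ∘ λ y∈⁅u'⁆ → x∈p∪q⁺ (inj₂ y∈⁅u'⁆)) (nonadjacent-to (hu' refl))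
    ∈-available⁺ {true}  {true}  y∈C hu hu' = ∈-minusN⁺ y∈C (∈C⇒∉cut y∈C) nonadj
      where
      nonadj : ∀ {x} → x ∈ ⁅ u ⁆ ∪ ⁅ u' ⁆ → adj x _ ≡ false
      nonadj x∈ with x∈p∪q⁻ ⁅ u ⁆ ⁅ u' ⁆ x∈
      ... | inj₁ x∈⁅u⁆ = nonadjacent-to (hu refl) x∈⁅u⁆
      ... | inj₂ x∈⁅u'⁆ = nonadjacent-to (hu' refl) x∈⁅u'⁆

    available-mono : ∀ {p q p' q'} → (p' ≡ true → p ≡ true) → (q' ≡ true → q ≡ true) →
                     available p q ⊆ available p' q'
    available-mono p'⇒p q'⇒q y∈ with ∈-available⁻ y∈
    ... | y∈C , hu , hu' = ∈-available⁺ y∈C (hu ∘ p'⇒p) (hu' ∘ q'⇒q)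

    α≤αG'+base : α adj w ⊤ ≤ αG' + base
    α≤αG'+base with α-attained adj w ⊤
    ... | T , _ , indT , α≡ = begin
      α adj w ⊤                                         ≡⟨ α≡ ⟩
      weightOf w T                                      ≡⟨ weightOf-partition w T C ⟩
      weightOf w out + weightOf w inside                ≤⟨ ℚ.+-monoʳ-≤ (weightOf w out) inside-bound ⟩
      weightOf w out + α adj w (available p q)          ≡⟨ cong (weightOf w out +_) (total-best p q) ⟨
      weightOf w out + (total (best p q) + base)        ≡⟨ ℚ.+-assoc (weightOf w out) _ _ ⟨
      (weightOf w out + total (best p q)) + base        ≡⟨ cong (_+ base) (weightOf-++ out (best p q)) ⟨
      weightOf (w' adj w u u' C) (out ++ best p q) + base ≤⟨ ℚ.+-monoˡ-≤ base reduced-bound ⟩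
      αG' + base                                        ∎
      where
      open ℚ.≤-Reasoning
      out inside : Subset n
      out = T ∩ ∁ C
      inside = T ∩ C
      p q : Bool
      p = lookup out u
      q = lookup out u'
      nonadjacent-from : ∀ {x y} → lookup out x ≡ true → y ∈ inside → adj x y ≡ false
      nonadjacent-from {x} e y∈ = indT (p∩q⊆p T (∁ C) (lookup⇒[]= x out e)) (p∩q⊆p T C y∈)
      inside⊆ : inside ⊆ available p q
      inside⊆ y∈ = ∈-available⁺ (p∩q⊆q T C y∈) (λ e → nonadjacent-from e y∈) (λ e → nonadjacent-from e y∈)
      inside-bound : weightOf w inside ≤ α adj w (available p q)
      inside-bound = α-upper adj w inside⊆ (Independent-⊆ (p∩q⊆p T C) indT)
      reduced-bound : weightOf (w' adj w u u' C) (out ++ best p q) ≤ αG'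
      reduced-bound = α-upper (adj' adj u u') (w' adj w u u' C) (++⊆V'⁺ (p∩q⊆q T (∁ C)))
                              (Independent-++⁺ (Independent-⊆ (p∩q⊆p T (∁ C)) indT) (best-compatible p q))

    module _ (symmetric : ∀ x y → adj x y ≡ adj y x) where

      outside-nonadjacent : ∀ {x y} → x ∉ C → x ≢ u → x ≢ u' → y ∈ C → adj x y ≡ false
      outside-nonadjacent {x} {y} x∉C x≢u x≢u' y∈C with adj x y in e
      ... | true = ⊥-elim (x∉C (closed y x y∈C (x∉p⇒x∈∁p (∉cut x≢u x≢u')) (trans (symmetric y x) e)))
        where closed = proj₂ (proj₂ (proj₂ component))
      ... | false = refl

      available-nonadjacent : ∀ {I x y} → I ⊆ ∁ C → x ∈ I → y ∈ available (lookup I u) (lookup I u') →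
                              adj x y ≡ false
      available-nonadjacent {I} {x} I⊆∁C x∈I y∈
        with ∈-available⁻ {lookup I u} {lookup I u'} y∈ | x ≟ u | x ≟ u'
      ... | _ , hu , _  | yes refl | _        = hu ([]=⇒lookup x∈I)
      ... | _ , _ , hu' | no _     | yes refl = hu' ([]=⇒lookup x∈I)
      ... | y∈C , _ , _ | no x≢u   | no x≢u'  = outside-nonadjacent (x∈∁p⇒x∉p (I⊆∁C x∈I)) x≢u x≢u' y∈C

      αG'+base≤α : α adj w (available false true) ≤ α adj w (available true false) → αG' + base ≤ α adj w ⊤
      αG'+base≤α α₂≤α₁ with α-attained (adj' adj u u') (w' adj w u u' C) (V' C)
      ... | T' , T'⊆V' , indT' , α≡ with Vec.splitAt n T'
      ...   | I , t , refl with Independent-++⁻ {I} {t} indT'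
      ...     | indI , compatible with α-attained adj w (available (lookup I u) (lookup I u'))
      ...       | J , J⊆ , indJ , αJ≡ = begin
        αG' + base                               ≡⟨ cong (_+ base) (trans α≡ (weightOf-++ I t)) ⟩
        (weightOf w I + total t) + base          ≡⟨ ℚ.+-assoc (weightOf w I) _ _ ⟩
        weightOf w I + (total t + base)          ≤⟨ ℚ.+-monoʳ-≤ (weightOf w I) gadget-bound ⟩
        weightOf w I + α adj w (available p q)   ≡⟨ cong (weightOf w I +_) αJ≡ ⟩
        weightOf w I + weightOf w J              ≡⟨ weightOf-∪ w disjoint ⟨
        weightOf w (I ∪ J)                       ≤⟨ α-upper adj w ⊆⊤ (Independent-∪ symmetric indI indJ across) ⟩
        α adj w ⊤                                ∎
        where
        open ℚ.≤-Reasoning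
        p q : Bool
        p = lookup I u
        q = lookup I u'
        I⊆∁C : I ⊆ ∁ C
        I⊆∁C = ++⊆V'⁻ T'⊆V'
        disjoint : ∀ {x} → x ∈ I → x ∉ J
        disjoint x∈I x∈J = x∈∁p⇒x∉p (I⊆∁C x∈I) (proj₁ (∈-available⁻ {p} {q} (J⊆ x∈J)))
        across : ∀ {x y} → x ∈ I → y ∈ J → adj x y ≡ false
        across x∈I y∈J = available-nonadjacent I⊆∁C x∈I (J⊆ y∈J)
        gadget-bound : total t + base ≤ α adj w (available p q)
        gadget-bound = total-≤
          (α-mono adj w (available-mono {true} {true} {false} {true} (λ _ → refl) (λ e → e)))
          α₂≤α₁
          (α-mono adj w (available-mono {true} {false} {false} {false} (λ ()) (λ ())))
          p q t compatible

lemma10 : ∀ {n} (adj : Adj n) (w : Weight n) → IsSimple adj → PositiveWeights w →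
          (u u' : Fin n) → IsVertexCut2 adj u u' →
          (C : Subset n) → IsComponent adj (∁ (⁅ u ⁆ ∪ ⁅ u' ⁆)) C →
          α adj w (minusN adj C ⁅ u' ⁆) ≤ α adj w (minusN adj C ⁅ u ⁆) →
          α adj w ⊤ ≡ α (adj' adj u u') (w' adj w u u' C) (V' C) + α adj w (minusN adj C (⁅ u ⁆ ∪ ⁅ u' ⁆))
lemma10 adj w simple _ u u' _ C component α₂≤α₁ =
  ℚ.≤-antisym (α≤αG'+base component) (αG'+base≤α component (proj₁ simple) α₂≤α₁)
  where open Reduction adj w u u' C
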